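{- Let $G$ be any chordal graph. Then $\mathbf{is}(G)\le |V(G)|-\omega(G)+1$.
   Context: All graphs are finite, simple and undirected. Given a universe $\mathcal U$ and a family $\mathcal F=\{S_1,\dots,S_t\}$ of subsets of $\mathcal U$, the intersection graph of $\mathcal F$ has vertices $v_1,\dots,v_t$ with $v_iv_j$ an edge iff $S_i\cap S_j\ne\emptyset$. $\mathbf{is}(G)$ is the smallest size of a universe over which $G$ can be represented as such an intersection graph. $\omega(G)$ is the maximum size of a clique in $G$. -}

module Defs where

open import Data.Nat using (ℕ; zero; suc; _+_; _≤_)
open import Data.Fin using (Fin; toℕ; fromℕ)
open import Data.Fin.Subset using (Subset; _∈_; _∩_; ∣_∣; Nonempty)
open import Data.Bool using (Bool; true)
open import Data.Product using (Σ; ∃; _×_)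
open import Relation.Binary.PropositionalEquality using (_≡_; _≢_)
open import Relation.Nullary using (¬_)
open import Function.Bundles using (_⇔_)
open import Function.Definitions using (Injective)

record Graph (n : ℕ) : Set where
  field
    adj    : Fin n → Fin n → Bool
    sym    : ∀ i j → adj i j ≡ adj j i
    irrefl : ∀ i → ¬ (adj i i ≡ true)

open Graph public

Adj : ∀ {n} → Graph n → Fin n → Fin n → Set
Adj G i j = adj G i j ≡ true

record Cycle4 {n : ℕ} (G : Graph n) (m : ℕ) : Set where
  field
    vtx      : Fin (4 + m) → Fin n
    distinct : Injective _≡_ _≡_ vtx
    step     : ∀ i j → toℕ j ≡ suc (toℕ i) → Adj G (vtx i) (vtx j)
    close    : Adj G (vtx (fromℕ (3 + m))) (vtx (Data.Fin.zero))

open Cycle4 public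

-- A chord: an edge between two cycle vertices that are not consecutive
-- on the cycle (positions i < j with j ≥ i + 2, excluding the pair {0, 3+m}).
HasChord : ∀ {n} {G : Graph n} {m} → Cycle4 G m → Set
HasChord {G = G} {m} C =
  Σ (Fin (4 + m)) λ i → Σ (Fin (4 + m)) λ j →
    (2 + toℕ i ≤ toℕ j) ×
    ¬ (toℕ i ≡ 0 × toℕ j ≡ 3 + m) ×
    Adj G (vtx C i) (vtx C j)

Chordal : ∀ {n} → Graph n → Set
Chordal G = ∀ m (C : Cycle4 G m) → HasChord C

IsClique : ∀ {n} → Graph n → Subset n → Set
IsClique G K = ∀ i j → i ∈ K → j ∈ K → i ≢ j → Adj G i j

IsCliqueNumber : ∀ {n} → Graph n → ℕ → Set
IsCliqueNumber G w =
  (Σ _ λ K → IsClique G K × ∣ K ∣ ≡ w) ×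
  (∀ K → IsClique G K → ∣ K ∣ ≤ w)

IntersectionRep : ∀ {n} → Graph n → (u : ℕ) → (Fin n → Subset u) → Set
IntersectionRep G u S =
  ∀ i j → i ≢ j → (Adj G i j ⇔ Nonempty (S i ∩ S j))

RepresentableOver : ∀ {n} → Graph n → ℕ → Set
RepresentableOver {n} G u = Σ (Fin n → Subset u) λ S → IntersectionRep G u S

-- Dirac's lemma, in the form used here: if G[X] is chordal and K is a clique
-- not containing X, some vertex of X ∖ K is simplicial in G[X].  Given
-- nonadjacent a, b ∈ X, let C be the component of b in X ∖ N[a] and S its
-- neighbourhood in X.  Then S ⊆ N(a), and S is a clique: two nonadjacent
-- vertices of S, joined by a shortest path through C and closed up through a,
-- would form a hole.  Recursing into the smaller set C ∪ S with the clique S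
-- gives a vertex of C simplicial in C ∪ S, hence in X, since its neighbours
-- all lie in C ∪ S.
--
-- Peeling off such vertices outside a maximum clique K builds the
-- representation: each removed vertex v adds one element to the universe,
-- shared by v and its neighbours (a clique), and once only K is left a single
-- element suffices.  This uses n − ω removals, so n − ω + 1 elements.

module Submission where

open import Defs hiding (sym)
open import Data.Bool using (true)
open import Data.Bool.Properties using () renaming (_≟_ to _≟ᵇ_)
open import Data.Empty using (⊥; ⊥-elim)
open import Data.Fin using (Fin; zero; suc; toℕ)
open import Data.Fin.Properties
  using (any?; toℕ-injective; toℕ<n; toℕ-fromℕ) renaming (_≟_ to _≟ᶠ_)
open import Data.Fin.Subset renaming (⊥ to ∅)
open import Data.Fin.Subset.Properties
open import Data.Nat using (ℕ; zero; suc; _+_; _∸_; _≤_; _<_; z≤n; s≤s)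
open import Data.Nat.Induction using (<-wellFounded)
open import Data.Nat.Properties
open import Data.Product using (Σ; ∃; ∃₂; _×_; _,_; proj₁; proj₂)
open import Data.Sum using (_⊎_; inj₁; inj₂; [_,_])
open import Data.Vec using (_∷_; tabulate; here; there)
open import Data.Vec.Properties using (lookup∘tabulate; []=⇒lookup; lookup⇒[]=)
open import Function using (_∘_)
open import Function.Bundles using (_⇔_; mk⇔; Equivalence)
open import Induction.WellFounded using (module All)
open import Relation.Binary using (tri<; tri≈; tri>)
open import Relation.Binary.Construct.On using (wellFounded)
open import Relation.Binary.PropositionalEquality
  using (_≡_; _≢_; refl; sym; trans; subst; subst₂; ≢-sym)
open import Relation.Nullary using (¬_; Dec; yes; no; does; contradiction)
open import Relation.Nullary.Decidable using (dec-true; _×-dec_; ¬?)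
open import Relation.Unary using (Decidable)

select : ∀ {n} {P : Fin n → Set} → Decidable P → Subset n
select P? = tabulate (λ v → does (P? v))

module _ {n} {P : Fin n → Set} (P? : Decidable P) where

  ∈-select⁺ : ∀ {v} → P v → v ∈ select P?
  ∈-select⁺ {v} pv = lookup⇒[]= v _ (trans (lookup∘tabulate _ v) (dec-true (P? v) pv))

  ∈-select⁻ : ∀ {v} → v ∈ select P? → P v
  ∈-select⁻ {v} v∈
    with P? v | trans (sym (lookup∘tabulate (λ w → does (P? w)) v)) ([]=⇒lookup v∈)
  ... | yes pv | _ = pv
  ... | no _   | ()

nonempty-∷∩∷⁻ : ∀ {u} x y {p q : Subset u} →
  Nonempty ((x ∷ p) ∩ (y ∷ q)) → (x ≡ true × y ≡ true) ⊎ Nonempty (p ∩ q)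
nonempty-∷∩∷⁻ true true (zero , here) = inj₁ (refl , refl)
nonempty-∷∩∷⁻ _ _ (suc e , there m) = inj₂ (e , m)

nonempty-∷∩∷⁺ : ∀ {u} x y {p q : Subset u} →
  (x ≡ true × y ≡ true) ⊎ Nonempty (p ∩ q) → Nonempty ((x ∷ p) ∩ (y ∷ q))
nonempty-∷∩∷⁺ _ _ (inj₁ (refl , refl)) = zero , here
nonempty-∷∩∷⁺ _ _ (inj₂ (e , m)) = suc e , there m

∅∩-empty : ∀ {u} (q : Subset u) → Empty (∅ ∩ q)
∅∩-empty q (_ , m) = ∉⊥ (proj₁ (x∈p∩q⁻ ∅ q m))

∩∅-empty : ∀ {u} (p : Subset u) → Empty (p ∩ ∅)
∩∅-empty p (_ , m) = ∉⊥ (proj₂ (x∈p∩q⁻ p ∅ m))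

∄-outside⇒⊆ : ∀ {n} {X K : Subset n} → ¬ (∃ λ v → v ∈ X × v ∉ K) → X ⊆ K
∄-outside⇒⊆ {K = K} ∄ {v} v∈X with v ∈? K
... | yes v∈K = v∈K
... | no v∉K = contradiction (v , v∈X , v∉K) ∄

module _ {n} (G : Graph n) where

  Adj-sym : ∀ {u v} → Adj G u v → Adj G v u
  Adj-sym {u} {v} = trans (Graph.sym G v u)

  adj? : ∀ u v → Dec (Adj G u v)
  adj? u v = adj G u v ≟ᵇ true

  Simplicial : Subset n → Fin n → Set
  Simplicial X v = ∀ {p q} → p ∈ X → q ∈ X → Adj G v p → Adj G v q → p ≢ q → Adj G p q

  record InducedPath (u : ℕ → Fin n) (ℓ : ℕ) : Set where
    field
      injective : ∀ {i k} → i < k → k ≤ ℓ → u i ≢ u k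
      edge      : ∀ {i} → i < ℓ → Adj G (u i) (u (suc i))
      chordless : ∀ {i k} → 2 + i ≤ k → k ≤ ℓ → ¬ Adj G (u i) (u k)

  data Walk (D : Subset n) (s : Fin n) : Fin n → Set where
    stay : Walk D s s
    move : ∀ {u v} → Walk D s u → v ∈ D → Adj G u v → Walk D s v

  walk-mono : ∀ {D E s t} → D ⊆ E → Walk D s t → Walk E s t
  walk-mono D⊆E stay = stay
  walk-mono D⊆E (move w v∈D u~v) = move (walk-mono D⊆E w) (D⊆E v∈D) u~v

  infixr 5 _++ᵂ_
  _++ᵂ_ : ∀ {D s t r} → Walk D s t → Walk D t r → Walk D s r
  w ++ᵂ stay = w
  w ++ᵂ move w′ v∈D u~v = move (w ++ᵂ w′) v∈D u~v

  walk-end∈ : ∀ {D s t} → s ∈ D → Walk D s t → t ∈ D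
  walk-end∈ s∈D stay = s∈D
  walk-end∈ s∈D (move _ v∈D _) = v∈D

  walk-reverse : ∀ {D s t} → s ∈ D → Walk D s t → Walk D t s
  walk-reverse s∈D stay = stay
  walk-reverse s∈D (move w _ u~v) =
    move stay (walk-end∈ s∈D w) (Adj-sym u~v) ++ᵂ walk-reverse s∈D w

  AdjacentTo : Subset n → Fin n → Set
  AdjacentTo P v = ∃ λ u → u ∈ P × Adj G u v

  adjacentTo? : ∀ P → Decidable (AdjacentTo P)
  adjacentTo? P v = any? (λ u → u ∈? P ×-dec adj? u v)

  adjacentTo : Subset n → Subset n
  adjacentTo P = select (adjacentTo? P)

  ∈-adjacentTo⁺ : ∀ P {u v} → u ∈ P → Adj G u v → v ∈ adjacentTo P
  ∈-adjacentTo⁺ P u∈P u~v = ∈-select⁺ (adjacentTo? P) (_ , u∈P , u~v)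

  ∈-adjacentTo⁻ : ∀ P {v} → v ∈ adjacentTo P → AdjacentTo P v
  ∈-adjacentTo⁻ P = ∈-select⁻ (adjacentTo? P)

  module Layers (D : Subset n) (s : Fin n) where

    layer : ℕ → Subset n
    layer zero    = ⁅ s ⁆
    layer (suc k) = layer k ∪ (D ∩ adjacentTo (layer k))

    layer-⊆-suc : ∀ k → layer k ⊆ layer (suc k)
    layer-⊆-suc k = p⊆p∪q _

    layer-mono : ∀ {k k′} → k ≤ k′ → layer k ⊆ layer k′
    layer-mono {k′ = zero}   z≤n = λ v∈ → v∈
    layer-mono {k′ = suc k′} k≤k′+1 with m≤n⇒m<n∨m≡n k≤k′+1
    ... | inj₁ (s≤s k≤k′) = λ v∈ → layer-⊆-suc k′ (layer-mono k≤k′ v∈)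
    ... | inj₂ refl       = λ v∈ → v∈

    layer-step : ∀ k {u v} → u ∈ layer k → v ∈ D → Adj G u v → v ∈ layer (suc k)
    layer-step k u∈ v∈D u~v =
      x∈p∪q⁺ (inj₂ (x∈p∩q⁺ (v∈D , ∈-adjacentTo⁺ (layer k) u∈ u~v)))

    layer-inv : ∀ k {v} → v ∈ layer (suc k) →
      v ∈ layer k ⊎ (v ∈ D × ∃ λ u → u ∈ layer k × Adj G u v)
    layer-inv k v∈ with x∈p∪q⁻ (layer k) _ v∈
    ... | inj₁ v∈k = inj₁ v∈k
    ... | inj₂ v∈new with x∈p∩q⁻ D _ v∈new
    ...   | v∈D , v∈adj = inj₂ (v∈D , ∈-adjacentTo⁻ (layer k) v∈adj)

    layer⊆D : ∀ k {v} → s ∈ D → v ∈ layer k → v ∈ D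
    layer⊆D zero s∈D v∈ = subst (_∈ D) (sym (x∈⁅y⁆⇒x≡y s v∈)) s∈D
    layer⊆D (suc k) s∈D v∈ with layer-inv k v∈
    ... | inj₁ v∈k = layer⊆D k s∈D v∈k
    ... | inj₂ (v∈D , _) = v∈D

    layer⇒walk : ∀ k {v} → v ∈ layer k → Walk (layer k) s v
    layer⇒walk zero v∈ rewrite x∈⁅y⁆⇒x≡y s v∈ = stay
    layer⇒walk (suc k) v∈ with layer-inv k v∈
    ... | inj₁ v∈k = walk-mono (layer-⊆-suc k) (layer⇒walk k v∈k)
    ... | inj₂ (_ , u , u∈k , u~v) =
      move (walk-mono (layer-⊆-suc k) (layer⇒walk k u∈k)) v∈ u~v

    walk⇒layer : ∀ {t} → Walk D s t → ∃ λ k → t ∈ layer k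
    walk⇒layer stay = 0 , x∈⁅x⁆ s
    walk⇒layer (move w v∈D u~v) with walk⇒layer w
    ... | k , u∈k = suc k , layer-step k u∈k v∈D u~v

    Stable : ℕ → Set
    Stable N = layer (suc N) ⊆ layer N

    stable-or-growing : ∀ k → (∃ Stable) ⊎ k < ∣ layer k ∣
    stable-or-growing zero = inj₂ (subst (0 <_) (sym (∣⁅x⁆∣≡1 s)) (s≤s z≤n))
    stable-or-growing (suc k) with stable-or-growing k
    ... | inj₁ stable = inj₁ stable
    ... | inj₂ k<∣k∣ with layer k ⊂? layer (suc k)
    ...   | yes ⊂suc = inj₂ (≤-<-trans k<∣k∣ (p⊂q⇒∣p∣<∣q∣ ⊂suc))
    ...   | no ⊄suc = inj₁ (k , stable)
      where
      stable : Stable k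
      stable {v} v∈ with v ∈? layer k
      ... | yes v∈k = v∈k
      ... | no v∉k = contradiction ((λ {x} → layer-⊆-suc k {x}) , v , v∈ , v∉k) ⊄suc

    stabilises : ∃ Stable
    stabilises with stable-or-growing n
    ... | inj₁ stable = stable
    ... | inj₂ n<∣n∣ = contradiction (∣p∣≤n (layer n)) (<⇒≱ n<∣n∣)

    private
      N : ℕ
      N = proj₁ stabilises

    component : Subset n
    component = layer N

    s∈component : s ∈ component
    s∈component = layer-mono {0} {N} z≤n (x∈⁅x⁆ s)

    component⊆D : s ∈ D → component ⊆ D
    component⊆D s∈D = layer⊆D N s∈D

    component-closed : ∀ {u v} → u ∈ component → v ∈ D → Adj G u v → v ∈ component
    component-closed u∈ v∈D u~v = proj₂ stabilises (layer-step N u∈ v∈D u~v)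

    component⇒walk : ∀ {v} → v ∈ component → Walk component s v
    component⇒walk = layer⇒walk N

    record Geodesic (j : ℕ) (v : Fin n) : Set where
      field
        path    : ℕ → Fin n
        start   : path 0 ≡ s
        end     : path j ≡ v
        reached : ∀ {i} → i ≤ j → path i ∈ layer i
        new     : ∀ {i} → i < j → path (suc i) ∉ layer i
        edge    : ∀ {i} → i < j → Adj G (path i) (path (suc i))
        within  : ∀ {i} → i < j → path (suc i) ∈ D

    geodesic⇒induced : ∀ {j v} (g : Geodesic j v) → InducedPath (Geodesic.path g) j
    geodesic⇒induced {j} g = record
      { injective = injective ; edge = edge ; chordless = chordless }
      where
      open Geodesic g
      injective : ∀ {i k} → i < k → k ≤ j → path i ≢ path k
      injective {k = suc k} (s≤s i≤k) k<j eq =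
        new k<j (subst (_∈ layer k) eq (layer-mono i≤k (reached (≤-trans i≤k (<⇒≤ k<j)))))
      chordless : ∀ {i k} → 2 + i ≤ k → k ≤ j → ¬ Adj G (path i) (path k)
      chordless {i} {suc k} (s≤s i<k) k<j i~k =
        new k<j (layer-mono i<k
          (layer-step i (reached (≤-trans (<⇒≤ i<k) (<⇒≤ k<j))) (within k<j) i~k))

    private
      snoc : (ℕ → Fin n) → ℕ → Fin n → ℕ → Fin n
      snoc u j v i with i ≤? j
      ... | yes _ = u i
      ... | no _  = v

      snoc-≤ : ∀ u {j} v {i} → i ≤ j → snoc u j v i ≡ u i
      snoc-≤ u {j} v {i} i≤j with i ≤? j
      ... | yes _   = refl
      ... | no i≰j  = contradiction i≤j i≰j

      snoc-last : ∀ u j v → snoc u j v (suc j) ≡ v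
      snoc-last u j v with suc j ≤? j
      ... | yes j+1≤j = contradiction j+1≤j (1+n≰n)
      ... | no _      = refl

    geodesic-extend : ∀ {k j w v} → Geodesic j w → j ≤ k → v ∉ layer k → v ∈ D → Adj G w v →
      Geodesic (suc j) v
    geodesic-extend {j = j} {w} {v} g j≤k v∉k v∈D w~v = record
      { path = path′ ; start = trans (snoc-≤ path {j} v z≤n) start ; end = snoc-last path j v
      ; reached = reached′ ; new = new′ ; edge = edge′ ; within = within′ }
      where
      open Geodesic g
      path′ = snoc path j v
      w∈j : w ∈ layer j
      w∈j = subst (_∈ layer j) end (reached ≤-refl)
      earlier : ∀ {i} → i ≤ j → path′ i ≡ path i
      earlier = snoc-≤ path v
      reached′ : ∀ {i} → i ≤ suc j → path′ i ∈ layer i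
      reached′ i≤j+1 with m≤n⇒m<n∨m≡n i≤j+1
      ... | inj₁ (s≤s i≤j) rewrite earlier i≤j = reached i≤j
      ... | inj₂ refl rewrite snoc-last path j v = layer-step j w∈j v∈D w~v
      new′ : ∀ {i} → i < suc j → path′ (suc i) ∉ layer i
      new′ (s≤s i≤j) with m≤n⇒m<n∨m≡n i≤j
      ... | inj₁ i<j rewrite earlier i<j = new i<j
      ... | inj₂ refl rewrite snoc-last path j v = λ v∈j → v∉k (layer-mono j≤k v∈j)
      edge′ : ∀ {i} → i < suc j → Adj G (path′ i) (path′ (suc i))
      edge′ (s≤s i≤j) with m≤n⇒m<n∨m≡n i≤j
      ... | inj₁ i<j rewrite earlier i<j | earlier (<⇒≤ i<j) = edge i<j
      ... | inj₂ refl rewrite snoc-last path j v | earlier (≤-refl {j}) =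
        subst (λ x → Adj G x v) (sym end) w~v
      within′ : ∀ {i} → i < suc j → path′ (suc i) ∈ D
      within′ (s≤s i≤j) with m≤n⇒m<n∨m≡n i≤j
      ... | inj₁ i<j rewrite earlier i<j = within i<j
      ... | inj₂ refl rewrite snoc-last path j v = v∈D

    geodesic : ∀ k {v} → v ∈ layer k → ∃ λ j → j ≤ k × Geodesic j v
    geodesic zero v∈ = 0 , z≤n , record
      { path = λ _ → s ; start = refl ; end = sym (x∈⁅y⁆⇒x≡y s v∈)
      ; reached = λ { z≤n → x∈⁅x⁆ s } ; new = λ () ; edge = λ () ; within = λ () }
    geodesic (suc k) {v} v∈ with v ∈? layer k
    ... | yes v∈k with geodesic k v∈k
    ...   | j , j≤k , g = j , m≤n⇒m≤1+n j≤k , g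
    geodesic (suc k) v∈ | no v∉k with layer-inv k v∈
    ... | inj₁ v∈k = contradiction v∈k v∉k
    ... | inj₂ (v∈D , w , w∈k , w~v) with geodesic k w∈k
    ...   | j , j≤k , g = suc j , s≤s j≤k , geodesic-extend g j≤k v∉k v∈D w~v

    walk⇒geodesic : ∀ {t} → Walk D s t → ∃ λ j → Geodesic j t
    walk⇒geodesic w with walk⇒layer w
    ... | k , t∈k with geodesic k t∈k
    ...   | j , _ , g = j , g

  NonadjacentPair : Subset n → Set
  NonadjacentPair X = ∃₂ λ a b → a ∈ X × b ∈ X × a ≢ b × ¬ Adj G a b

  nonadjacent-pair? : ∀ X → Dec (NonadjacentPair X)
  nonadjacent-pair? X =
    any? λ a → any? λ b → a ∈? X ×-dec b ∈? X ×-dec ¬? (a ≟ᶠ b) ×-dec ¬? (adj? a b)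

  ¬nonadjacent-pair⇒clique : ∀ {X} → ¬ NonadjacentPair X → IsClique G X
  ¬nonadjacent-pair⇒clique ¬pair p q p∈X q∈X p≢q with adj? p q
  ... | yes p~q = p~q
  ... | no p≁q = contradiction (p , q , p∈X , q∈X , p≢q , p≁q) ¬pair

  clique-nonneighbour : ∀ {K a c} → IsClique G K → a ∈ K → a ≢ c → ¬ Adj G a c → c ∉ K
  clique-nonneighbour K-clique a∈K a≢c a≁c c∈K = a≁c (K-clique _ _ a∈K c∈K a≢c)

  RepresentsOn : Subset n → (u : ℕ) → (Fin n → Subset u) → Set
  RepresentsOn X u S = ∀ {i j} → i ∈ X → j ∈ X → i ≢ j → Adj G i j ⇔ Nonempty (S i ∩ S j)

  clique-represents : ∀ {X} → IsClique G X → RepresentsOn X 1 (λ _ → ⁅ zero ⁆)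
  clique-represents X-clique {i} {j} i∈X j∈X i≢j =
    mk⇔ (λ _ → zero , here) (λ _ → X-clique i j i∈X j∈X i≢j)

  -- The new element 0 is shared by v and its neighbours; v keeps no other
  -- element, so the set S v (on which S carries no information) is dropped.
  attach : ∀ {u} → Fin n → (Fin n → Subset u) → Fin n → Subset (suc u)
  attach v S i with v ≟ᶠ i
  ... | yes _ = inside ∷ ∅
  ... | no _  = adj G v i ∷ S i

  attach-represents : ∀ {X v u S} → v ∈ X → Simplicial X v → RepresentsOn (X - v) u S →
    RepresentsOn X (suc u) (attach v S)
  attach-represents {v = v} {S = S} v∈X simplicial rep {i} {j} i∈X j∈X i≢j
    with v ≟ᶠ i | v ≟ᶠ j
  ... | yes refl | yes refl = contradiction refl i≢j
  ... | yes refl | no _ = mk⇔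
    (λ v~j → nonempty-∷∩∷⁺ true (adj G v j) (inj₁ (refl , v~j)))
    (λ ne → [ proj₂ , ⊥-elim ∘ ∅∩-empty (S j) ] (nonempty-∷∩∷⁻ true (adj G v j) ne))
  ... | no _ | yes refl = mk⇔
    (λ i~v → nonempty-∷∩∷⁺ (adj G v i) true (inj₁ (Adj-sym i~v , refl)))
    (λ ne → [ Adj-sym ∘ proj₁ , ⊥-elim ∘ ∩∅-empty (S i) ] (nonempty-∷∩∷⁻ (adj G v i) true ne))
  ... | no v≢i | no v≢j = mk⇔
    (λ i~j → nonempty-∷∩∷⁺ (adj G v i) (adj G v j) (inj₂ (Equivalence.to rep′ i~j)))
    (λ ne → [ (λ (v~i , v~j) → simplicial i∈X j∈X v~i v~j i≢j) , Equivalence.from rep′ ]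
              (nonempty-∷∩∷⁻ (adj G v i) (adj G v j) ne))
    where
    rep′ = rep (x∈p∧x≢y⇒x∈p-y i∈X (≢-sym v≢i)) (x∈p∧x≢y⇒x∈p-y j∈X (≢-sym v≢j)) i≢j

  module _ (chordal : Chordal G) where

    no-hole : ∀ {u m a} → InducedPath u (2 + m) →
      Adj G a (u 0) → Adj G a (u (2 + m)) →
      (∀ {i} → i ≤ 2 + m → a ≢ u i) →
      (∀ {i} → 0 < i → i < 2 + m → ¬ Adj G a (u i)) → ⊥
    no-hole {u} {m} {a} P a~first a~last a∉P a≁P = chord-free (chordal m hole)
      where
      open InducedPath P
      cyc : ℕ → Fin n
      cyc zero    = a
      cyc (suc t) = u t
      cyc-injective : ∀ {t t′} → t ≤ 3 + m → t′ ≤ 3 + m → cyc t ≡ cyc t′ → t ≡ t′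
      cyc-injective {zero}  {zero}   _ _ _ = refl
      cyc-injective {zero}  {suc t′} _ t′≤ eq = contradiction eq (a∉P (≤-pred t′≤))
      cyc-injective {suc t} {zero}   t≤ _ eq = contradiction (sym eq) (a∉P (≤-pred t≤))
      cyc-injective {suc t} {suc t′} t≤ t′≤ eq with <-cmp t t′
      ... | tri< t<t′ _ _ = contradiction eq (injective t<t′ (≤-pred t′≤))
      ... | tri≈ _ refl _ = refl
      ... | tri> _ _ t′<t = contradiction (sym eq) (injective t′<t (≤-pred t≤))
      bound : (i : Fin (4 + m)) → toℕ i ≤ 3 + m
      bound i = ≤-pred (toℕ<n i)
      hole : Cycle4 G m
      hole = record
        { vtx = λ i → cyc (toℕ i)
        ; distinct = λ {i} {i′} eq → toℕ-injective (cyc-injective (bound i) (bound i′) eq)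
        ; step = around
        ; close = subst (λ t → Adj G (cyc t) a) (sym (toℕ-fromℕ (3 + m))) (Adj-sym a~last) }
        where
        around : ∀ i j → toℕ j ≡ suc (toℕ i) → Adj G (cyc (toℕ i)) (cyc (toℕ j))
        around i j eq with toℕ i | toℕ j | bound j | eq
        ... | zero  | _ | _  | refl = a~first
        ... | suc t | _ | j≤ | refl = edge (≤-pred j≤)
      chord-free : HasChord hole → ⊥
      chord-free (i , j , 2+i≤j , not-closing , i~j) =
        go (toℕ i) (toℕ j) 2+i≤j not-closing i~j (bound j)
        where
        go : ∀ t t′ → 2 + t ≤ t′ → ¬ (t ≡ 0 × t′ ≡ 3 + m) → Adj G (cyc t) (cyc t′) →
          t′ ≤ 3 + m → ⊥
        go zero (suc t′) 2≤ not-closing a~t′ t′≤ with t′ ≟ 2 + m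
        ... | yes refl = not-closing (refl , refl)
        ... | no t′≢ = a≁P (≤-pred 2≤) (≤∧≢⇒< (≤-pred t′≤) t′≢) a~t′
        go (suc t) (suc t′) 2+t≤ _ t~t′ t′≤ = chordless (≤-pred 2+t≤) (≤-pred t′≤) t~t′

    no-geodesic-hole : ∀ {D p q a j} → Layers.Geodesic D p j q → p ≢ q → ¬ Adj G p q →
      Adj G a p → Adj G a q → a ≢ p → a ∉ D →
      (∀ {v} → v ∈ D → v ≢ p → v ≢ q → ¬ Adj G a v) → ⊥
    no-geodesic-hole {j = zero} g p≢q _ _ _ _ _ _ = p≢q (trans (sym start) end)
      where open Layers.Geodesic g
    no-geodesic-hole {j = suc zero} g _ p≁q _ _ _ _ _ =
      p≁q (subst₂ (Adj G) start end (edge (s≤s z≤n)))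
      where open Layers.Geodesic g
    no-geodesic-hole {D} {p} {a = a} {suc (suc m)} g _ _ a~p a~q a≢p a∉D far-inside =
      no-hole P (subst (Adj G a) (sym start) a~p) (subst (Adj G a) (sym end) a~q) a∉path a≁interior
      where
      open Layers.Geodesic g
      P = Layers.geodesic⇒induced D p g
      a∉path : ∀ {i} → i ≤ 2 + m → a ≢ path i
      a∉path {zero} _ eq = a≢p (trans eq start)
      a∉path {suc i} i<j eq = a∉D (subst (_∈ D) (sym eq) (within i<j))
      a≁interior : ∀ {i} → 0 < i → i < 2 + m → ¬ Adj G a (path i)
      a≁interior {suc i} 0<i i<j = far-inside (within (<⇒≤ i<j))
        (λ eq → InducedPath.injective P 0<i (<⇒≤ i<j) (trans start (sym eq)))
        (λ eq → InducedPath.injective P i<j ≤-refl (trans eq (sym end)))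

    record Separator (X : Subset n) (a b : Fin n) : Set where
      field
        Y S             : Subset n
        Y⊆X             : Y ⊆ X
        a∉Y             : a ∉ Y
        S-clique        : IsClique G S
        b∈Y             : b ∈ Y
        b∉S             : b ∉ S
        interior-far    : ∀ {c} → c ∈ Y → c ∉ S → ¬ Adj G a c
        interior-closed : ∀ {c d} → c ∈ Y → c ∉ S → d ∈ X → Adj G c d → d ∈ Y

    module SeparatorConstruction (X : Subset n) (a b : Fin n)
                                 (b∈X : b ∈ X) (a≢b : a ≢ b) (a≁b : ¬ Adj G a b) where

      Far : Fin n → Set
      Far v = v ∈ X × a ≢ v × ¬ Adj G a v

      far? : Decidable Far
      far? v = v ∈? X ×-dec ¬? (a ≟ᶠ v) ×-dec ¬? (adj? a v)

      b∈far : b ∈ select far?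
      b∈far = ∈-select⁺ far? (b∈X , a≢b , a≁b)

      open Layers (select far?) b
        using (component; s∈component; component⊆D; component-closed; component⇒walk)

      C : Subset n
      C = component

      C-far : ∀ {c} → c ∈ C → Far c
      C-far c∈C = ∈-select⁻ far? (component⊆D b∈far c∈C)

      a∉C : a ∉ C
      a∉C a∈C = proj₁ (proj₂ (C-far a∈C)) refl

      Boundary : Fin n → Set
      Boundary v = v ∈ X × v ∉ C × AdjacentTo C v

      boundary? : Decidable Boundary
      boundary? v = v ∈? X ×-dec ¬? (v ∈? C) ×-dec adjacentTo? C v

      S : Subset n
      S = select boundary?

      S-adj : ∀ {p} → p ∈ S → Adj G a p
      S-adj {p} p∈S with ∈-select⁻ boundary? p∈S | adj? a p
      ... | _ | yes a~p = a~p
      ... | p∈X , p∉C , c , c∈C , c~p | no a≁p =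
        contradiction (component-closed c∈C (∈-select⁺ far? (p∈X , a≢p , a≁p)) c~p) p∉C
        where
        a≢p : a ≢ p
        a≢p refl = proj₂ (proj₂ (C-far c∈C)) (Adj-sym c~p)

      a∉S : a ∉ S
      a∉S a∈S = irrefl G a (S-adj a∈S)

      S-nonadjacent-pair : ∀ {p q} → p ∈ S → q ∈ S → p ≢ q → ¬ Adj G p q → ⊥
      S-nonadjacent-pair {p} {q} p∈S q∈S p≢q p≁q
        with ∈-select⁻ boundary? p∈S | ∈-select⁻ boundary? q∈S
      ... | _ , _ , p′ , p′∈C , p′~p | _ , _ , q′ , q′∈C , q′~q =
        no-geodesic-hole (proj₂ (Layers.walk⇒geodesic D p walk)) p≢q p≁q (S-adj p∈S) (S-adj q∈S)
          (λ { refl → a∉S p∈S }) a∉D far-inside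
        where
        D : Subset n
        D = C ∪ (⁅ p ⁆ ∪ ⁅ q ⁆)
        C⊆D : C ⊆ D
        C⊆D = p⊆p∪q _
        q∈D : q ∈ D
        q∈D = x∈p∪q⁺ (inj₂ (x∈p∪q⁺ (inj₂ (x∈⁅x⁆ q))))
        D-cases : ∀ {v} → v ∈ D → v ≢ p → v ≢ q → v ∈ C
        D-cases v∈D v≢p v≢q with x∈p∪q⁻ C _ v∈D
        ... | inj₁ v∈C = v∈C
        ... | inj₂ v∈pq with x∈p∪q⁻ ⁅ p ⁆ ⁅ q ⁆ v∈pq
        ...   | inj₁ v∈p = contradiction (x∈⁅y⁆⇒x≡y p v∈p) v≢p
        ...   | inj₂ v∈q = contradiction (x∈⁅y⁆⇒x≡y q v∈q) v≢q
        a∉D : a ∉ D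
        a∉D a∈D = a∉C (D-cases a∈D (λ { refl → a∉S p∈S }) (λ { refl → a∉S q∈S }))
        walk : Walk D p q
        walk = move stay (C⊆D p′∈C) (Adj-sym p′~p)
          ++ᵂ walk-mono C⊆D
                (walk-reverse s∈component (component⇒walk p′∈C) ++ᵂ component⇒walk q′∈C)
          ++ᵂ move stay q∈D q′~q
        far-inside : ∀ {v} → v ∈ D → v ≢ p → v ≢ q → ¬ Adj G a v
        far-inside v∈D v≢p v≢q = proj₂ (proj₂ (C-far (D-cases v∈D v≢p v≢q)))

      S-clique : IsClique G S
      S-clique p q p∈S q∈S p≢q with adj? p q
      ... | yes p~q = p~q
      ... | no p≁q = ⊥-elim (S-nonadjacent-pair p∈S q∈S p≢q p≁q)

      Y : Subset n
      Y = C ∪ S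

      interior⊆C : ∀ {c} → c ∈ Y → c ∉ S → c ∈ C
      interior⊆C c∈Y c∉S with x∈p∪q⁻ C S c∈Y
      ... | inj₁ c∈C = c∈C
      ... | inj₂ c∈S = contradiction c∈S c∉S

      separator : Separator X a b
      separator = record
        { Y = Y ; S = S
        ; Y⊆X = Y⊆X
        ; a∉Y = λ a∈Y → a∉C (interior⊆C a∈Y a∉S)
        ; S-clique = S-clique
        ; b∈Y = x∈p∪q⁺ (inj₁ s∈component)
        ; b∉S = λ b∈S → proj₁ (proj₂ (∈-select⁻ boundary? b∈S)) s∈component
        ; interior-far = λ c∈Y c∉S → proj₂ (proj₂ (C-far (interior⊆C c∈Y c∉S)))
        ; interior-closed = interior-closed }
        where
        Y⊆X : Y ⊆ X
        Y⊆X v∈Y with x∈p∪q⁻ C S v∈Y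
        ... | inj₁ v∈C = proj₁ (C-far v∈C)
        ... | inj₂ v∈S = proj₁ (∈-select⁻ boundary? v∈S)
        interior-closed : ∀ {c d} → c ∈ Y → c ∉ S → d ∈ X → Adj G c d → d ∈ Y
        interior-closed {c} {d} c∈Y c∉S d∈X c~d with d ∈? C
        ... | yes d∈C = x∈p∪q⁺ (inj₁ d∈C)
        ... | no d∉C =
          x∈p∪q⁺ (inj₂ (∈-select⁺ boundary? (d∈X , d∉C , c , interior⊆C c∈Y c∉S , c~d)))

    SimplicialOutside : Subset n → Set
    SimplicialOutside X = ∀ K → IsClique G K → ∀ {v₀} → v₀ ∈ X → v₀ ∉ K →
      ∃ λ v → v ∈ X × v ∉ K × Simplicial X v

    far-simplicial : ∀ {X a b} → (∀ {Y} → ∣ Y ∣ < ∣ X ∣ → SimplicialOutside Y) →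
      a ∈ X → b ∈ X → a ≢ b → ¬ Adj G a b →
      ∃ λ c → c ∈ X × a ≢ c × ¬ Adj G a c × Simplicial X c
    far-simplicial {X} {a} {b} rec a∈X b∈X a≢b a≁b =
      lift (rec (p⊂q⇒∣p∣<∣q∣ (Y⊆X , a , a∈X , a∉Y)) S S-clique b∈Y b∉S)
      where
      open Separator (SeparatorConstruction.separator X a b b∈X a≢b a≁b)
      lift : (∃ λ c → c ∈ Y × c ∉ S × Simplicial Y c) →
        ∃ λ c → c ∈ X × a ≢ c × ¬ Adj G a c × Simplicial X c
      lift (c , c∈Y , c∉S , simplicial) =
        c , Y⊆X c∈Y , (λ { refl → a∉Y c∈Y }) , interior-far c∈Y c∉S ,
        λ p∈X q∈X c~p c~q → simplicial (interior-closed c∈Y c∉S p∈X c~p)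
                                       (interior-closed c∈Y c∉S q∈X c~q) c~p c~q

    simplicial-outside : ∀ X → SimplicialOutside X
    simplicial-outside = All.wfRec (wellFounded ∣_∣ <-wellFounded) _ SimplicialOutside go
      where
      go : ∀ X → (∀ {Y} → ∣ Y ∣ < ∣ X ∣ → SimplicialOutside Y) → SimplicialOutside X
      go X rec K K-clique {v₀} v₀∈X v₀∉K with nonadjacent-pair? X
      ... | no ¬pair =
        v₀ , v₀∈X , v₀∉K , λ p∈X q∈X _ _ → ¬nonadjacent-pair⇒clique ¬pair _ _ p∈X q∈X
      ... | yes (a , b , a∈X , b∈X , a≢b , a≁b) with a ∈? K | far-simplicial rec a∈X b∈X a≢b a≁b
      ...   | yes a∈K | c , c∈X , a≢c , a≁c , c-simplicial =
        c , c∈X , clique-nonneighbour K-clique a∈K a≢c a≁c , c-simplicial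
      ...   | no _   | c , c∈X , a≢c , a≁c , c-simplicial with c ∈? K
      ...     | no c∉K = c , c∈X , c∉K , c-simplicial
      -- c may lie in K, but then anything nonadjacent to c is outside K.
      ...     | yes c∈K with far-simplicial rec c∈X a∈X (≢-sym a≢c) (a≁c ∘ Adj-sym)
      ...       | d , d∈X , c≢d , c≁d , d-simplicial =
        d , d∈X , clique-nonneighbour K-clique c∈K c≢d c≁d , d-simplicial

    SmallRepresentation : Subset n → Set
    SmallRepresentation X = ∀ K → K ⊆ X → IsClique G K →
      ∃ λ u → u + ∣ K ∣ ≤ ∣ X ∣ + 1 × Σ (Fin n → Subset u) (RepresentsOn X u)

    small-representation : ∀ X → SmallRepresentation X
    small-representation = All.wfRec (wellFounded ∣_∣ <-wellFounded) _ SmallRepresentation go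
      where
      go : ∀ X → (∀ {Y} → ∣ Y ∣ < ∣ X ∣ → SmallRepresentation Y) → SmallRepresentation X
      go X rec K K⊆X K-clique with any? (λ v → v ∈? X ×-dec ¬? (v ∈? K))
      ... | no ∄outside =
        1 , subst (_≤ ∣ X ∣ + 1) (+-comm ∣ K ∣ 1) (+-monoˡ-≤ 1 (p⊆q⇒∣p∣≤∣q∣ K⊆X)) ,
        (λ _ → ⁅ zero ⁆) , clique-represents (λ i j i∈X j∈X → K-clique i j (X⊆K i∈X) (X⊆K j∈X))
        where
        X⊆K : X ⊆ K
        X⊆K = ∄-outside⇒⊆ ∄outside
      ... | yes (v₀ , v₀∈X , v₀∉K) with simplicial-outside X K K-clique v₀∈X v₀∉K
      ...   | v , v∈X , v∉K , v-simplicial with rec (x∈p⇒∣p-x∣<∣p∣ v∈X) K K⊆X-v K-clique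
        where
        K⊆X-v : K ⊆ X - v
        K⊆X-v k∈K = x∈p∧x≢y⇒x∈p-y (K⊆X k∈K) (λ { refl → v∉K k∈K })
      ...     | u , bound , S , rep =
        suc u , ≤-trans (s≤s bound) (+-monoˡ-≤ 1 (x∈p⇒∣p-x∣<∣p∣ v∈X)) ,
        attach v S , attach-represents v∈X v-simplicial rep

m+n≤o+1⇒m≤o∸n+1 : ∀ m {n o} → m + n ≤ o + 1 → n ≤ o → m ≤ o ∸ n + 1
m+n≤o+1⇒m≤o∸n+1 m m+n≤o+1 n≤o =
  subst (m ≤_) (+-∸-comm 1 n≤o) (m+n≤o⇒m≤o∸n m m+n≤o+1)

lemma3 : ∀ (n : ℕ) (G : Graph n) → Chordal G → ∀ (w : ℕ) → IsCliqueNumber G w →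
    Σ ℕ λ u → (u ≤ n ∸ w + 1) × RepresentableOver G u
lemma3 n G chordal w ((K , K-clique , refl) , _)
  with small-representation G chordal ⊤ K ⊆⊤ K-clique
... | u , bound , S , rep =
  u , m+n≤o+1⇒m≤o∸n+1 u (subst (λ m → u + ∣ K ∣ ≤ m + 1) (∣⊤∣≡n n) bound) (∣p∣≤n K) ,
  S , λ i j i≢j → rep ∈⊤ ∈⊤ i≢j
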